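{- Let $t\ge 1$ and $n\ge t$. The number of permutations of $\{1,\dots,n\}$ that are sorted by the left-greedy algorithm on $t$ stacks in series (and hence sortable by $t$ stacks in series) is at least $t!\,(t+1)^{n-t}$.
   Context: Sorting with $t$ stacks in series: the positions, ordered from right to left, are the input, stack $1$, ..., stack $t$, and the output. A permutation starts in the input, whose elements are taken in order from left to right. Legal moves: move the next input element onto the top of stack $1$; for $1\le k<t$ move the top of stack $k$ onto the top of stack $k+1$; move the top of stack $t$ to the output, allowed only if it is the smallest element not yet output. Moves into stacks are legal only if every stack remains increasing from top to bottom (smallest on top). A move is further left than another if its destination is further left. The left-greedy algorithm always performs the leftmost legal move. It fails if not all elements are output and no legal move exists; it sorts the permutation if it outputs all elements (in increasing order) without failing. -}

module Defs where

open import Data.Nat using (ℕ; zero; suc; _≤ᵇ_; _<ᵇ_; _∸_; _*_; _^_; _+_)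
open import Data.Bool using (Bool; true; false; if_then_else_; _∧_)
open import Data.List using (List; []; _∷_; concat; replicate; map; upTo; null; length)
open import Data.Maybe using (Maybe; just; nothing)

-- Configuration of t stacks in series.
-- stacks is the list  stack 1, stack 2, ..., stack t  (each stack is a list with its top first).
-- output is the list of elements already output (most recent first).
record State : Set where
  constructor ⟨_,_,_⟩
  field
    input  : List ℕ
    stacks : List (List ℕ)
    output : List ℕ
open State public

-- pushing x onto stack s keeps it increasing from top to bottom (smallest on top)
canPush : ℕ → List ℕ → Bool
canPush x []      = true
canPush x (y ∷ _) = x <ᵇ y

all : (ℕ → Bool) → List ℕ → Bool
all p []       = true
all p (x ∷ xs) = p x ∧ all p xs

allL : (List ℕ → Bool) → List (List ℕ) → Bool
allL p []       = true
allL p (x ∷ xs) = p x ∧ allL p xs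

lastStack : List (List ℕ) → List ℕ
lastStack []           = []
lastStack (s ∷ [])     = s
lastStack (_ ∷ s ∷ ss) = lastStack (s ∷ ss)

popLast : List (List ℕ) → List (List ℕ)
popLast []            = []
popLast ((_ ∷ s) ∷ []) = s ∷ []
popLast ([] ∷ [])      = [] ∷ []
popLast (s ∷ s' ∷ ss) = s ∷ popLast (s' ∷ ss)

-- Move: top of stack t to the output, legal only if that element is the
-- smallest element not yet output (i.e. ≤ every element still in the input or stacks).
moveOut : State → Maybe State
moveOut ⟨ inp , sts , out ⟩ with lastStack sts
... | []    = nothing
... | x ∷ _ = if all (x ≤ᵇ_) inp ∧ all (x ≤ᵇ_) (concat sts)
              then just ⟨ inp , popLast sts , x ∷ out ⟩
              else nothing

-- Move: top of stack k onto stack k+1 (1 ≤ k < t), choosing the legal such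
-- move whose destination is furthest left (largest k).
moveShift : List (List ℕ) → Maybe (List (List ℕ))
moveShift []            = nothing
moveShift (s ∷ [])      = nothing
moveShift (s ∷ s' ∷ ss) with moveShift (s' ∷ ss)
... | just r  = just (s ∷ r)
... | nothing with s
...   | []    = nothing
...   | x ∷ s₀ = if canPush x s' then just (s₀ ∷ (x ∷ s') ∷ ss) else nothing

moveIn : State → Maybe State
moveIn ⟨ x ∷ inp , s ∷ sts , out ⟩ =
  if canPush x s then just ⟨ inp , (x ∷ s) ∷ sts , out ⟩ else nothing
moveIn _ = nothing

-- One step of the left-greedy algorithm: perform the leftmost legal move
-- (destination output, then stack t, ..., then stack 1); nothing if no legal move.
greedyStep : State → Maybe State
greedyStep st with moveOut st
... | just st' = just st'
... | nothing with moveShift (stacks st)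
...   | just sts' = just ⟨ input st , sts' , output st ⟩
...   | nothing   = moveIn st

run : ℕ → State → Maybe State
run zero    st = just st
run (suc k) st with greedyStep st
... | just st' = run k st'
... | nothing  = nothing

initial : ℕ → List ℕ → State
initial t p = ⟨ p , replicate t [] , [] ⟩

AllOutput : State → Set
AllOutput st = (null (input st) ∧ allL null (stacks st)) ≡ᵇ true
  where
  open import Relation.Binary.PropositionalEquality using (_≡_)
  _≡ᵇ_ : Bool → Bool → Set
  a ≡ᵇ b = a ≡ b

-- The left-greedy algorithm on t stacks in series sorts p: after some number of
-- greedy moves (never getting stuck) all elements have been output.
-- (Outputs are automatically in increasing order by the rule for output moves.)
LeftGreedySorts : ℕ → List ℕ → Set
LeftGreedySorts t p = Σ ℕ λ k → Σ State λ st → (run k (initial t p) ≡ just st) × AllOutput st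
  where
  open import Data.Product using (Σ; _×_)
  open import Relation.Binary.PropositionalEquality using (_≡_)

oneTo : ℕ → List ℕ
oneTo n = map suc (upTo n)

{-# OPTIONS --safe #-}

-- Call a list t-bounded when each entry has at most t larger entries to its left.
-- Left-greedy sorts every t-bounded permutation.  Invariant: the stacks are increasing and
-- each input entry has at most t larger entries in the stacks or earlier in the input.
-- Each move lowers the number of moves still needed by one, so the algorithm halts.  When
-- no shift is legal, the tops decrease from the first non-empty stack down to the top b of
-- stack t, so b is the least stacked entry.  Hence if it halts with entries left, the input
-- holds some y < b.  As pushing the first input entry x is illegal too, x is at least the
-- top of stack 1, all t stacks are non-empty and y comes after x; then x and the t tops
-- are t + 1 entries before y exceeding it.
--
-- Distinct t-bounded permutations of 1, …, m + 1 arise from the t-bounded permutations of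
-- 1, …, m by raising every entry by one and inserting 1 after j ≤ min(m, t) entries; this
-- gives ∏_{m<n} (1 + min(m, t)) = t! (t + 1)^(n − t) of them.

module Submission where

open import Defs
open import Data.Bool using (true; false; T; if_then_else_; _∧_)
open import Data.Empty using (⊥; ⊥-elim)
open import Data.List using (List; []; _∷_; _++_; concat; length; map; null; replicate; upTo; cartesianProduct)
open import Data.List.Properties using (length-++; length-map; length-replicate; length-upTo; map-∘; map-id; map-id-local; map-injective; map-upTo)
open import Data.List.Membership.Propositional using (_∈_)
open import Data.List.Membership.Propositional.Properties using (∈-cartesianProduct⁻; ∈-upTo⁻)
open import Data.List.Relation.Unary.All as All using (All; []; _∷_)
import Data.List.Relation.Unary.All.Properties as AllP
open import Data.List.Relation.Unary.Any using (Any; here; there)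
open import Data.List.Relation.Unary.Any.Properties using (¬Any[])
open import Data.List.Relation.Unary.Linked as Linked using (Linked; []; [-]; _∷_)
open import Data.List.Relation.Unary.Linked.Properties using (Linked⇒All)
open import Data.List.Relation.Unary.AllPairs using ([]; _∷_)
open import Data.List.Relation.Unary.Unique.Propositional using (Unique)
import Data.List.Relation.Unary.Unique.Propositional.Properties as Unique
open import Data.List.Relation.Binary.Permutation.Propositional as ↭ using (_↭_; ↭-refl; ↭-prep; ↭-trans)
import Data.List.Relation.Binary.Permutation.Propositional.Properties as ↭
open import Data.Maybe using (just; nothing)
open import Data.Nat using (ℕ; zero; suc; pred; _+_; _*_; _∸_; _^_; _⊓_; _!; _≤_; _<_; _≤ᵇ_; _<ᵇ_; z≤n; s≤s)
open import Data.Nat.Properties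
open import Data.Nat.Induction using (<-wellFounded)
open import Data.Nat.Tactic.RingSolver using (solve-∀)
open import Data.Product using (Σ; ∃; ∃₂; _×_; _,_; proj₁; proj₂; uncurry)
import Data.Product as Product
open import Data.Unit using (⊤; tt)
open import Induction.WellFounded using (Acc; acc)
open import Relation.Binary.PropositionalEquality

-- Larger entries to the left

exceeds : ℕ → ℕ → ℕ
exceeds x z = if z <ᵇ x then 1 else 0

larger : ℕ → List ℕ → ℕ
larger z []       = 0
larger z (x ∷ xs) = exceeds x z + larger z xs

larger-++ : ∀ z xs ys → larger z (xs ++ ys) ≡ larger z xs + larger z ys
larger-++ z []       ys = refl
larger-++ z (x ∷ xs) ys =
  trans (cong (exceeds x z +_) (larger-++ z xs ys)) (sym (+-assoc (exceeds x z) _ _))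

larger-↭ : ∀ z {xs ys} → xs ↭ ys → larger z xs ≡ larger z ys
larger-↭ z ↭.refl          = refl
larger-↭ z (↭.prep x p)    = cong (exceeds x z +_) (larger-↭ z p)
larger-↭ z (↭.swap x y p)  =
  trans (cong (λ n → exceeds x z + (exceeds y z + n)) (larger-↭ z p)) (left-comm (exceeds x z) (exceeds y z) _)
  where
  left-comm : ∀ a b c → a + (b + c) ≡ b + (a + c)
  left-comm = solve-∀
larger-↭ z (↭.trans p q)   = trans (larger-↭ z p) (larger-↭ z q)

larger-∷-≤ : ∀ z x xs → larger z (x ∷ xs) ≤ suc (larger z xs)
larger-∷-≤ z x xs with z <ᵇ x
... | true  = ≤-refl
... | false = n≤1+n _

larger-∷-< : ∀ {z x} xs → z < x → larger z (x ∷ xs) ≡ suc (larger z xs)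
larger-∷-< {z} {x} xs z<x with z <ᵇ x | <⇒<ᵇ z<x
... | true | _ = refl

larger-map-suc : ∀ z xs → larger (suc z) (map suc xs) ≡ larger z xs
larger-map-suc z []       = refl
larger-map-suc z (x ∷ xs) = cong (exceeds x z +_) (larger-map-suc z xs)

-- `seen` holds the entries read so far, in any order.
AtMostLargerBefore : ℕ → List ℕ → List ℕ → Set
AtMostLargerBefore t seen []       = ⊤
AtMostLargerBefore t seen (y ∷ ys) = larger y seen ≤ t × AtMostLargerBefore t (y ∷ seen) ys

AtMostLargerBefore-mono : ∀ {t seen seen′} ys → (∀ z → larger z seen′ ≤ larger z seen) →
  AtMostLargerBefore t seen ys → AtMostLargerBefore t seen′ ys
AtMostLargerBefore-mono []       le _          = tt
AtMostLargerBefore-mono (y ∷ ys) le (bd , rest) =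
  ≤-trans (le y) bd , AtMostLargerBefore-mono ys (λ z → +-monoʳ-≤ _ (le z)) rest

AtMostLargerBefore-∃< : ∀ {t b} seen ys → AtMostLargerBefore t seen ys → Any (_< b) ys →
  ∃ λ y → y < b × larger y seen ≤ t
AtMostLargerBefore-∃< seen (y ∷ ys) (bd , _) (here y<b) = y , y<b , bd
AtMostLargerBefore-∃< seen (y ∷ ys) (_ , rest) (there below)
  with z , z<b , bd ← AtMostLargerBefore-∃< (y ∷ seen) ys rest below =
  z , z<b , ≤-trans (m≤n+m _ _) bd

AtMostLargerBefore-map-suc : ∀ {t} seen ys → AtMostLargerBefore t seen ys →
  AtMostLargerBefore t (map suc seen) (map suc ys)
AtMostLargerBefore-map-suc seen []       _           = tt
AtMostLargerBefore-map-suc seen (y ∷ ys) (bd , rest) =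
  subst (_≤ _) (sym (larger-map-suc y seen)) bd , AtMostLargerBefore-map-suc (y ∷ seen) ys rest

-- Moves, potential and invariant

<ᵇ-true⇒< : ∀ {m n} → (m <ᵇ n) ≡ true → m < n
<ᵇ-true⇒< {m} {n} e = <ᵇ⇒< m n (subst T (sym e) tt)

<ᵇ-false⇒≥ : ∀ {m n} → (m <ᵇ n) ≡ false → n ≤ m
<ᵇ-false⇒≥ e = ≮⇒≥ λ m<n → subst T e (<⇒<ᵇ m<n)

all-≤ᵇ-complete : ∀ {b} xs → All (b ≤_) xs → all (b ≤ᵇ_) xs ≡ true
all-≤ᵇ-complete     []       []           = refl
all-≤ᵇ-complete {b} (x ∷ xs) (b≤x ∷ b≤xs) with b ≤ᵇ x | ≤⇒≤ᵇ b≤x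
... | true | _ = all-≤ᵇ-complete xs b≤xs

all-≤ᵇ-false : ∀ {b} xs → all (b ≤ᵇ_) xs ≡ false → Any (_< b) xs
all-≤ᵇ-false {b} (x ∷ xs) e with b ≤ᵇ x in b≤ᵇx
... | true  = there (all-≤ᵇ-false xs e)
... | false = here (≰⇒> λ b≤x → subst T b≤ᵇx (≤⇒≤ᵇ b≤x))

canPush-Linked : ∀ {x} s → canPush x s ≡ true → Linked _<_ s → Linked _<_ (x ∷ s)
canPush-Linked []      _ _   = [-]
canPush-Linked (y ∷ s) c inc = <ᵇ-true⇒< c ∷ inc

data Shifted : List (List ℕ) → List (List ℕ) → Set where
  here  : ∀ {x s s′ ss} → canPush x s′ ≡ true → Shifted ((x ∷ s) ∷ s′ ∷ ss) (s ∷ (x ∷ s′) ∷ ss)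
  there : ∀ {s sts sts′} → Shifted sts sts′ → Shifted (s ∷ sts) (s ∷ sts′)

data Popped (x : ℕ) : List (List ℕ) → List (List ℕ) → Set where
  here  : ∀ {s} → Popped x ((x ∷ s) ∷ []) (s ∷ [])
  there : ∀ {s sts sts′} → Popped x sts sts′ → Popped x (s ∷ sts) (s ∷ sts′)

-- Output moves are taken without their side condition: no invariant below depends on it.
data _⟶_ : State → State → Set where
  push  : ∀ {x inp s sts out} → canPush x s ≡ true →
          ⟨ x ∷ inp , s ∷ sts , out ⟩ ⟶ ⟨ inp , (x ∷ s) ∷ sts , out ⟩
  shift : ∀ {inp sts sts′ out} → Shifted sts sts′ → ⟨ inp , sts , out ⟩ ⟶ ⟨ inp , sts′ , out ⟩
  pop   : ∀ {x inp sts sts′ out} → Popped x sts sts′ → ⟨ inp , sts , out ⟩ ⟶ ⟨ inp , sts′ , x ∷ out ⟩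

moveShift⇒Shifted : ∀ sts {sts′} → moveShift sts ≡ just sts′ → Shifted sts sts′
moveShift⇒Shifted ([] ∷ s′ ∷ ss) with moveShift (s′ ∷ ss) in e
... | just _  = λ { refl → there (moveShift⇒Shifted (s′ ∷ ss) e) }
... | nothing = λ ()
moveShift⇒Shifted ((x ∷ s) ∷ s′ ∷ ss) with moveShift (s′ ∷ ss) in e
... | just _  = λ { refl → there (moveShift⇒Shifted (s′ ∷ ss) e) }
... | nothing with canPush x s′ in c
...   | true  = λ { refl → here c }
...   | false = λ ()

lastStack⇒Popped : ∀ sts {x r} → lastStack sts ≡ x ∷ r → Popped x sts (popLast sts)
lastStack⇒Popped ((x ∷ r) ∷ [])       refl = here
lastStack⇒Popped ([] ∷ s′ ∷ ss)       e    = there (lastStack⇒Popped (s′ ∷ ss) e)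
lastStack⇒Popped ((y ∷ s) ∷ s′ ∷ ss)  e    = there (lastStack⇒Popped (s′ ∷ ss) e)

moveOut⇒⟶ : ∀ st {st′} → moveOut st ≡ just st′ → st ⟶ st′
moveOut⇒⟶ ⟨ inp , sts , out ⟩ with lastStack sts in e
... | []    = λ ()
... | x ∷ r with all (x ≤ᵇ_) inp ∧ all (x ≤ᵇ_) (concat sts)
...   | true  = λ { refl → pop (lastStack⇒Popped sts e) }
...   | false = λ ()

moveIn⇒⟶ : ∀ st {st′} → moveIn st ≡ just st′ → st ⟶ st′
moveIn⇒⟶ ⟨ []    , _      , _   ⟩ = λ ()
moveIn⇒⟶ ⟨ _ ∷ _ , []     , _   ⟩ = λ ()
moveIn⇒⟶ ⟨ x ∷ _ , s ∷ _  , _   ⟩ with canPush x s in c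
... | true  = λ { refl → push c }
... | false = λ ()

greedyStep⇒⟶ : ∀ st {st′} → greedyStep st ≡ just st′ → st ⟶ st′
greedyStep⇒⟶ st with moveOut st in eO
... | just _ = λ { refl → moveOut⇒⟶ st eO }
... | nothing with moveShift (stacks st) in eS
...   | just _  = λ { refl → shift (moveShift⇒Shifted (stacks st) eS) }
...   | nothing = moveIn⇒⟶ st

greedyStep-stuck : ∀ st → greedyStep st ≡ nothing →
  moveOut st ≡ nothing × moveShift (stacks st) ≡ nothing × moveIn st ≡ nothing
greedyStep-stuck st with moveOut st in eO
... | just _ = λ ()
... | nothing with moveShift (stacks st) in eS
...   | just _  = λ ()
...   | nothing = λ eI → refl , refl , eI

-- The number of moves still needed to output everything: t + 1 for an input entry and
-- t − k + 1 for an entry of stack k.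
stackPotential : List (List ℕ) → ℕ
stackPotential []       = 0
stackPotential (s ∷ ss) = suc (length ss) * length s + stackPotential ss

potential : State → ℕ
potential st = suc (length (stacks st)) * length (input st) + stackPotential (stacks st)

weighted-suc : ∀ a {n n′ p p′} → n′ ≡ n → p ≡ suc p′ → suc n * a + p ≡ suc (suc n′ * a + p′)
weighted-suc a refl refl = +-suc _ _

Shifted-length : ∀ {sts sts′} → Shifted sts sts′ → length sts′ ≡ length sts
Shifted-length (here _)  = refl
Shifted-length (there p) = cong suc (Shifted-length p)

Shifted-potential : ∀ {sts sts′} → Shifted sts sts′ → stackPotential sts ≡ suc (stackPotential sts′)
Shifted-potential (here {s = s} {s′} {ss} _) =
  arith (length ss) (length s) (length s′) (stackPotential ss)
  where
  arith : ∀ l a b p → suc (suc l) * suc a + (suc l * b + p) ≡ suc (suc (suc l) * a + (suc l * suc b + p))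
  arith = solve-∀
Shifted-potential (there {s} p) = weighted-suc (length s) (Shifted-length p) (Shifted-potential p)

Shifted-↭ : ∀ {sts sts′} → Shifted sts sts′ → concat sts′ ↭ concat sts
Shifted-↭ (here {x} {s} {s′} {ss} _) = ↭.shift x s (s′ ++ concat ss)
Shifted-↭ (there {s} p)              = ↭.++⁺ˡ s (Shifted-↭ p)

Shifted-increasing : ∀ {sts sts′} → Shifted sts sts′ → All (Linked _<_) sts → All (Linked _<_) sts′
Shifted-increasing (here {s′ = s′} c) (inc ∷ inc′ ∷ incs) = Linked.tail inc ∷ canPush-Linked s′ c inc′ ∷ incs
Shifted-increasing (there p)          (inc ∷ incs)        = inc ∷ Shifted-increasing p incs

Popped-length : ∀ {x sts sts′} → Popped x sts sts′ → length sts′ ≡ length sts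
Popped-length here      = refl
Popped-length (there p) = cong suc (Popped-length p)

Popped-potential : ∀ {x sts sts′} → Popped x sts sts′ → stackPotential sts ≡ suc (stackPotential sts′)
Popped-potential here         = refl
Popped-potential (there {s} p) = weighted-suc (length s) (Popped-length p) (Popped-potential p)

Popped-↭ : ∀ {x sts sts′} → Popped x sts sts′ → concat sts ↭ x ∷ concat sts′
Popped-↭ here                            = ↭-refl
Popped-↭ {x} (there {s} {sts′ = sts′} p) = ↭-trans (↭.++⁺ˡ s (Popped-↭ p)) (↭.shift x s (concat sts′))

Popped-increasing : ∀ {x sts sts′} → Popped x sts sts′ → All (Linked _<_) sts → All (Linked _<_) sts′
Popped-increasing here      (inc ∷ [])   = Linked.tail inc ∷ []
Popped-increasing (there p) (inc ∷ incs) = inc ∷ Popped-increasing p incs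

⟶-potential : ∀ {st st′} → st ⟶ st′ → potential st ≡ suc (potential st′)
⟶-potential (push {inp = inp} {s} {sts} _) =
  arith (length sts) (length inp) (length s) (stackPotential sts)
  where
  arith : ∀ l i a p → suc (suc l) * suc i + (suc l * a + p) ≡ suc (suc (suc l) * i + (suc l * suc a + p))
  arith = solve-∀
⟶-potential (shift {inp} p) = weighted-suc (length inp) (Shifted-length p) (Shifted-potential p)
⟶-potential (pop {inp = inp} p) = weighted-suc (length inp) (Popped-length p) (Popped-potential p)

record Invariant (t : ℕ) (st : State) : Set where
  field
    stackCount : length (stacks st) ≡ t
    increasing : All (Linked _<_) (stacks st)
    fewLarger  : AtMostLargerBefore t (concat (stacks st)) (input st)
open Invariant

⟶-invariant : ∀ {t st st′} → Invariant t st → st ⟶ st′ → Invariant t st′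
⟶-invariant inv (push {s = s} c) with inc ∷ incs ← increasing inv = record
  { stackCount = stackCount inv
  ; increasing = canPush-Linked s c inc ∷ incs
  ; fewLarger  = proj₂ (fewLarger inv)
  }
⟶-invariant inv (shift {inp} p) = record
  { stackCount = trans (Shifted-length p) (stackCount inv)
  ; increasing = Shifted-increasing p (increasing inv)
  ; fewLarger  = AtMostLargerBefore-mono inp (λ z → ≤-reflexive (larger-↭ z (Shifted-↭ p))) (fewLarger inv)
  }
⟶-invariant inv (pop {x} {inp} p) = record
  { stackCount = trans (Popped-length p) (stackCount inv)
  ; increasing = Popped-increasing p (increasing inv)
  ; fewLarger  = AtMostLargerBefore-mono inp
      (λ z → ≤-trans (m≤n+m _ (exceeds x z)) (≤-reflexive (sym (larger-↭ z (Popped-↭ p)))))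
      (fewLarger inv)
  }

-- Stuck configurations and halting

data Blocked : List ℕ → List ℕ → Set where
  empty   : ∀ {s′} → Blocked [] s′
  smaller : ∀ {x y s s′} → y ≤ x → Blocked (x ∷ s) (y ∷ s′)

data NonEmpty : List ℕ → Set where
  nonEmpty : ∀ {x s} → NonEmpty (x ∷ s)

TopAtLeast : ℕ → List ℕ → Set
TopAtLeast b []      = ⊤
TopAtLeast b (a ∷ _) = b ≤ a

canPush-false⇒Blocked : ∀ {x} s s′ → canPush x s′ ≡ false → Blocked (x ∷ s) s′
canPush-false⇒Blocked s (y ∷ s′) c = smaller (<ᵇ-false⇒≥ c)

moveShift-stuck-tail : ∀ s s′ ss → moveShift (s ∷ s′ ∷ ss) ≡ nothing → moveShift (s′ ∷ ss) ≡ nothing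
moveShift-stuck-tail s s′ ss with moveShift (s′ ∷ ss)
... | just _  = λ ()
... | nothing = λ _ → refl

moveShift-stuck-head : ∀ s s′ ss → moveShift (s ∷ s′ ∷ ss) ≡ nothing → Blocked s s′
moveShift-stuck-head [] s′ ss _ = empty
moveShift-stuck-head (x ∷ s) s′ ss with moveShift (s′ ∷ ss)
... | just _ = λ ()
... | nothing with canPush x s′ in c
...   | true  = λ ()
...   | false = λ _ → canPush-false⇒Blocked s s′ c

moveShift-stuck : ∀ sts → moveShift sts ≡ nothing → Linked Blocked sts
moveShift-stuck []            _  = []
moveShift-stuck (_ ∷ [])      _  = [-]
moveShift-stuck (s ∷ s′ ∷ ss) eq =
  moveShift-stuck-head s s′ ss eq ∷ moveShift-stuck (s′ ∷ ss) (moveShift-stuck-tail s s′ ss eq)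

moveIn-stuck : ∀ {x inp s sts out} → moveIn ⟨ x ∷ inp , s ∷ sts , out ⟩ ≡ nothing → canPush x s ≡ false
moveIn-stuck {x} {s = s} with canPush x s
... | true  = λ ()
... | false = λ _ → refl

moveOut-stuck : ∀ inp sts out {b r} → lastStack sts ≡ b ∷ r → All (b ≤_) (concat sts) →
  moveOut ⟨ inp , sts , out ⟩ ≡ nothing → Any (_< b) inp
moveOut-stuck inp sts out {b} eL stacks≥b with lastStack sts | eL
... | _ | refl with all (b ≤ᵇ_) inp in e | all (b ≤ᵇ_) (concat sts) | all-≤ᵇ-complete (concat sts) stacks≥b
...   | false | _     | _    = λ _ → all-≤ᵇ-false inp e
...   | true  | .true | refl = λ ()

Blocked-NonEmpty : ∀ {s s′} → Blocked s s′ → NonEmpty s → NonEmpty s′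
Blocked-NonEmpty (smaller _) nonEmpty = nonEmpty

Blocked-TopAtLeast : ∀ {b s s′} → Blocked s s′ → TopAtLeast b s′ → TopAtLeast b s
Blocked-TopAtLeast empty         _   = tt
Blocked-TopAtLeast (smaller y≤x) b≤y = ≤-trans b≤y y≤x

Blocked-all-NonEmpty : ∀ {s sts} → Linked Blocked (s ∷ sts) → NonEmpty s → All NonEmpty (s ∷ sts)
Blocked-all-NonEmpty [-]        ne = ne ∷ []
Blocked-all-NonEmpty (bl ∷ bls) ne = ne ∷ Blocked-all-NonEmpty bls (Blocked-NonEmpty bl ne)

Blocked-Any-NonEmpty : ∀ {s s′ ss} → Blocked s s′ → Any NonEmpty (s ∷ s′ ∷ ss) → Any NonEmpty (s′ ∷ ss)
Blocked-Any-NonEmpty bl (here ne)    = here (Blocked-NonEmpty bl ne)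
Blocked-Any-NonEmpty bl (there rest) = rest

Blocked-lastStack : ∀ {sts} → Linked Blocked sts → Any NonEmpty sts →
  ∃₂ λ b r → lastStack sts ≡ b ∷ r × All (TopAtLeast b) sts
Blocked-lastStack [-] (here (nonEmpty {b} {r})) = b , r , refl , ≤-refl ∷ []
Blocked-lastStack (bl ∷ bls) ne
  with b , r , eL , tops@(top ∷ _) ← Blocked-lastStack bls (Blocked-Any-NonEmpty bl ne) =
  b , r , eL , Blocked-TopAtLeast bl top ∷ tops

TopAtLeast-concat : ∀ {b sts} → All (TopAtLeast b) sts → All (Linked _<_) sts → All (b ≤_) (concat sts)
TopAtLeast-concat tops incs = AllP.concat⁺ (All.zipWith stack≥ (tops , incs))
  where
  stack≥ : ∀ {b s} → TopAtLeast b s × Linked _<_ s → All (b ≤_) s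
  stack≥ {s = []}    _           = []
  stack≥ {s = _ ∷ _} (b≤a , inc) = Linked⇒All ≤-trans b≤a (Linked.map <⇒≤ inc)

length≤larger-concat : ∀ {y b} sts → y < b → All NonEmpty sts → All (TopAtLeast b) sts →
  length sts ≤ larger y (concat sts)
length≤larger-concat []                y<b []              []           = z≤n
length≤larger-concat {y} ((a ∷ s) ∷ sts) y<b (nonEmpty ∷ nes) (b≤a ∷ tops) = begin
  suc (length sts)                   ≤⟨ s≤s (length≤larger-concat sts y<b nes tops) ⟩
  suc (larger y (concat sts))        ≤⟨ s≤s (m≤n+m _ (larger y s)) ⟩
  suc (larger y s + larger y (concat sts)) ≡⟨ cong suc (larger-++ y s (concat sts)) ⟨
  suc (larger y (s ++ concat sts))   ≡⟨ larger-∷-< (s ++ concat sts) (<-≤-trans y<b b≤a) ⟨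
  larger y (a ∷ s ++ concat sts)     ∎
  where open ≤-Reasoning

someNonEmpty : ∀ sts → allL null sts ≡ false → Any NonEmpty sts
someNonEmpty ([] ∷ sts)      e = there (someNonEmpty sts e)
someNonEmpty ((_ ∷ _) ∷ sts) _ = here nonEmpty

¬stuck-with-input : ∀ {t x inp s sts out} → Invariant t ⟨ x ∷ inp , s ∷ sts , out ⟩ →
  moveOut ⟨ x ∷ inp , s ∷ sts , out ⟩ ≡ nothing → moveShift (s ∷ sts) ≡ nothing →
  moveIn ⟨ x ∷ inp , s ∷ sts , out ⟩ ≡ nothing → ⊥
¬stuck-with-input {t} {x} {inp} {s} {sts} {out} inv noOut noShift noIn =
  refute (Blocked-lastStack blocked (here nonEmpty)) (Blocked-all-NonEmpty blocked nonEmpty)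
  where
  blocked : Linked Blocked ((x ∷ inp) ∷ s ∷ sts)
  blocked = canPush-false⇒Blocked inp s (moveIn-stuck noIn) ∷ moveShift-stuck (s ∷ sts) noShift

  refute : (∃₂ λ b r → lastStack (s ∷ sts) ≡ b ∷ r × All (TopAtLeast b) ((x ∷ inp) ∷ s ∷ sts)) →
           All NonEmpty ((x ∷ inp) ∷ s ∷ sts) → ⊥
  refute (b , r , eL , b≤x ∷ tops) (_ ∷ nes)
    with moveOut-stuck (x ∷ inp) (s ∷ sts) out eL (TopAtLeast-concat tops (increasing inv)) noOut
  ... | here x<b = <⇒≱ x<b b≤x
  ... | there below with y , y<b , few ← AtMostLargerBefore-∃< _ inp (proj₂ (fewLarger inv)) below =
    <-irrefl refl (begin-strict
      t                                 ≡⟨ stackCount inv ⟨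
      length (s ∷ sts)                  ≤⟨ length≤larger-concat (s ∷ sts) y<b nes tops ⟩
      larger y (concat (s ∷ sts))       <⟨ n<1+n _ ⟩
      suc (larger y (concat (s ∷ sts))) ≡⟨ larger-∷-< (concat (s ∷ sts)) (<-≤-trans y<b b≤x) ⟨
      larger y (x ∷ concat (s ∷ sts))   ≤⟨ few ⟩
      t                                 ∎)
    where open ≤-Reasoning

stuck⇒AllOutput : ∀ {t} st → 1 ≤ t → Invariant t st → greedyStep st ≡ nothing → AllOutput st
stuck⇒AllOutput ⟨ [] , sts , out ⟩ _ inv stuck with allL null sts in e
... | true  = refl
... | false
  with noOut , noShift , _ ← greedyStep-stuck ⟨ [] , sts , out ⟩ stuck
  with b , r , eL , tops ← Blocked-lastStack (moveShift-stuck sts noShift) (someNonEmpty sts e)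
  = ⊥-elim (¬Any[] (moveOut-stuck [] sts out eL (TopAtLeast-concat tops (increasing inv)) noOut))
stuck⇒AllOutput ⟨ _ ∷ _ , [] , _ ⟩ t≥1 inv _ = ⊥-elim (<⇒≢ t≥1 (stackCount inv))
stuck⇒AllOutput st@(⟨ _ ∷ _ , _ ∷ _ , _ ⟩) _ inv stuck
  with noOut , noShift , noIn ← greedyStep-stuck st stuck
  = ⊥-elim (¬stuck-with-input inv noOut noShift noIn)

Finishes : State → Set
Finishes st = Σ ℕ λ k → Σ State λ st′ → (run k st ≡ just st′) × AllOutput st′

run-suc : ∀ k {st st′} → greedyStep st ≡ just st′ → run (suc k) st ≡ run k st′
run-suc k eq rewrite eq = refl

greedy-finishes : ∀ {t} → 1 ≤ t → ∀ st → Acc _<_ (potential st) → Invariant t st → Finishes st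
greedy-finishes t≥1 st (acc rec) inv with greedyStep st in e
... | nothing = 0 , st , refl , stuck⇒AllOutput st t≥1 inv e
... | just st′
  with step ← greedyStep⇒⟶ st e
  with k , final , runs , done ← greedy-finishes t≥1 st′ (rec (≤-reflexive (sym (⟶-potential step))))
                                    (⟶-invariant inv step)
  = suc k , final , trans (run-suc k {st} e) runs , done

concat-replicate-[] : ∀ n → concat (replicate n ([] {A = ℕ})) ≡ []
concat-replicate-[] zero    = refl
concat-replicate-[] (suc n) = concat-replicate-[] n

leftGreedy-sorts : ∀ {t p} → 1 ≤ t → AtMostLargerBefore t [] p → LeftGreedySorts t p
leftGreedy-sorts {t} {p} t≥1 few = greedy-finishes t≥1 (initial t p) (<-wellFounded _) record
  { stackCount = length-replicate t
  ; increasing = AllP.replicate⁺ t []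
  ; fewLarger  = subst (λ seen → AtMostLargerBefore t seen p) (sym (concat-replicate-[] t)) few
  }

-- Counting the permutations

insertAt : ∀ {A : Set} → ℕ → A → List A → List A
insertAt zero    x ys       = x ∷ ys
insertAt (suc j) x []       = x ∷ []
insertAt (suc j) x (y ∷ ys) = y ∷ insertAt j x ys

insertAt-↭ : ∀ {A : Set} j (x : A) ys → insertAt j x ys ↭ x ∷ ys
insertAt-↭ zero    x ys       = ↭-refl
insertAt-↭ (suc j) x []       = ↭-refl
insertAt-↭ (suc j) x (y ∷ ys) = ↭-trans (↭-prep y (insertAt-↭ j x ys)) (↭.↭-swap y x ↭-refl)

-- The inserted 0 is exceeded by the j entries before it and exceeds nothing after it.
AtMostLargerBefore-insertAt-0 : ∀ {t} j seen ys → j + larger 0 seen ≤ t →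
  AtMostLargerBefore t seen ys → AtMostLargerBefore t seen (insertAt j 0 ys)
AtMostLargerBefore-insertAt-0 zero seen ys bd rest =
  bd , AtMostLargerBefore-mono ys (λ _ → ≤-refl) rest
AtMostLargerBefore-insertAt-0 (suc j) seen [] bd _ = ≤-trans (m≤n+m _ _) bd , tt
AtMostLargerBefore-insertAt-0 (suc j) seen (y ∷ ys) bd (bd′ , rest) =
  bd′ , AtMostLargerBefore-insertAt-0 j (y ∷ seen) ys
          (≤-trans (+-monoʳ-≤ j (larger-∷-≤ 0 y seen)) (≤-trans (≤-reflexive (+-suc j _)) bd)) rest

insertZero : ℕ → List ℕ → List ℕ
insertZero j q = insertAt j 0 (map suc q)

extractZero : List ℕ → ℕ × List ℕ
extractZero []           = 0 , []
extractZero (zero ∷ ys)  = 0 , map pred ys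
extractZero (suc y ∷ ys) = Product.map suc (y ∷_) (extractZero ys)

map-pred-suc : ∀ xs → map pred (map suc xs) ≡ xs
map-pred-suc xs = trans (sym (map-∘ xs)) (map-id xs)

extractZero-insertZero : ∀ j q → j ≤ length q → extractZero (insertZero j q) ≡ (j , q)
extractZero-insertZero zero    q       _         = cong (0 ,_) (map-pred-suc q)
extractZero-insertZero (suc j) (y ∷ q) (s≤s j≤q) =
  cong (Product.map suc (y ∷_)) (extractZero-insertZero j q j≤q)

Unique-map-retraction : ∀ {A B : Set} {f : A → B} (g : B → A) {xs} →
  All (λ x → g (f x) ≡ x) xs → Unique xs → Unique (map f xs)
Unique-map-retraction g {xs} retract xs! =
  Unique.map⁻ {f = g} (subst Unique (sym (trans (sym (map-∘ xs)) (map-id-local retract))) xs!)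

length-cartesianProduct : ∀ {A B : Set} (xs : List A) (ys : List B) →
  length (cartesianProduct xs ys) ≡ length xs * length ys
length-cartesianProduct []       ys = refl
length-cartesianProduct (x ∷ xs) ys =
  trans (length-++ (map (x ,_) ys)) (cong₂ _+_ (length-map (x ,_) ys) (length-cartesianProduct xs ys))

BoundedPerm : ℕ → ℕ → List ℕ → Set
BoundedPerm t m p = p ↭ upTo m × AtMostLargerBefore t [] p

positions : ℕ → ℕ → List ℕ
positions t m = upTo (suc (m ⊓ t))

-- Permutations of 0, …, m − 1, raised to 1, …, m only at the end, so that the inserted
-- entry 0 is below every raised entry and can be located again.
boundedPerms : ℕ → ℕ → List (List ℕ)
boundedPerms t zero    = [] ∷ []
boundedPerms t (suc m) = map (uncurry insertZero) (cartesianProduct (positions t m) (boundedPerms t m))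

insertZero-BoundedPerm : ∀ {t m j q} → j ≤ t → BoundedPerm t m q → BoundedPerm t (suc m) (insertZero j q)
insertZero-BoundedPerm {t} {m} {j} {q} j≤t (q↭ , few) =
  ↭-trans (insertAt-↭ j 0 (map suc q)) (↭-prep 0 (subst (map suc q ↭_) (map-upTo suc m) (↭.map⁺ suc q↭))) ,
  AtMostLargerBefore-insertAt-0 j [] (map suc q) (subst (_≤ t) (sym (+-identityʳ j)) j≤t)
    (AtMostLargerBefore-map-suc [] q few)

∈-pairs⁻ : ∀ {t m j q} → (j , q) ∈ cartesianProduct (positions t m) (boundedPerms t m) →
  j ≤ m ⊓ t × q ∈ boundedPerms t m
∈-pairs⁻ mem with j∈ , q∈ ← ∈-cartesianProduct⁻ _ _ mem = ≤-pred (∈-upTo⁻ j∈) , q∈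

boundedPerms-sound : ∀ t m → All (BoundedPerm t m) (boundedPerms t m)
boundedPerms-sound t zero    = (↭-refl , tt) ∷ []
boundedPerms-sound t (suc m) = AllP.map⁺ (All.tabulate λ { {j , q} mem →
  let j≤ , q∈ = ∈-pairs⁻ mem in
  insertZero-BoundedPerm (≤-trans j≤ (m⊓n≤n m t)) (All.lookup (boundedPerms-sound t m) q∈) })

boundedPerms-unique : ∀ t m → Unique (boundedPerms t m)
boundedPerms-unique t zero    = [] ∷ []
boundedPerms-unique t (suc m) =
  Unique-map-retraction {f = uncurry insertZero} extractZero
    (All.tabulate λ { {j , q} mem → decode (∈-pairs⁻ mem) })
    (Unique.cartesianProduct⁺ (Unique.upTo⁺ (suc (m ⊓ t))) (boundedPerms-unique t m))
  where
  decode : ∀ {j q} → j ≤ m ⊓ t × q ∈ boundedPerms t m → extractZero (insertZero j q) ≡ (j , q)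
  decode {j} {q} (j≤ , q∈) = extractZero-insertZero j q (begin
    j               ≤⟨ ≤-trans j≤ (m⊓n≤m m t) ⟩
    m               ≡⟨ length-upTo m ⟨
    length (upTo m) ≡⟨ ↭.↭-length (proj₁ (All.lookup (boundedPerms-sound t m) q∈)) ⟨
    length q        ∎)
    where open ≤-Reasoning

length-boundedPerms-suc : ∀ t m → length (boundedPerms t (suc m)) ≡ suc (m ⊓ t) * length (boundedPerms t m)
length-boundedPerms-suc t m =
  trans (length-map (uncurry insertZero) (cartesianProduct (positions t m) (boundedPerms t m)))
    (trans (length-cartesianProduct (positions t m) (boundedPerms t m))
      (cong (_* length (boundedPerms t m)) (length-upTo (suc (m ⊓ t)))))

length-boundedPerms-≤ : ∀ {t} m → m ≤ t → length (boundedPerms t m) ≡ m !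
length-boundedPerms-≤     zero    _   = refl
length-boundedPerms-≤ {t} (suc m) m<t =
  trans (length-boundedPerms-suc t m)
    (cong₂ (λ a b → suc a * b) (m≤n⇒m⊓n≡m (<⇒≤ m<t)) (length-boundedPerms-≤ m (<⇒≤ m<t)))

length-boundedPerms : ∀ t d → length (boundedPerms t (d + t)) ≡ t ! * suc t ^ d
length-boundedPerms t zero    = trans (length-boundedPerms-≤ t ≤-refl) (sym (*-identityʳ (t !)))
length-boundedPerms t (suc d) = begin
  length (boundedPerms t (suc d + t))                    ≡⟨ length-boundedPerms-suc t (d + t) ⟩
  suc ((d + t) ⊓ t) * length (boundedPerms t (d + t))    ≡⟨ cong₂ (λ a b → suc a * b) (m≥n⇒m⊓n≡n (m≤n+m t d))
                                                                                     (length-boundedPerms t d) ⟩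
  suc t * (t ! * suc t ^ d)                              ≡⟨ left-comm (suc t) (t !) (suc t ^ d) ⟩
  t ! * suc t ^ suc d                                    ∎
  where
  open ≡-Reasoning
  left-comm : ∀ a b c → a * (b * c) ≡ b * (a * c)
  left-comm = solve-∀

mainTheorem6 : (t n : ℕ) → 1 ≤ t → t ≤ n →
    Σ (List (List ℕ)) λ L →
      Unique L
      × All (λ p → (p ↭ oneTo n) × LeftGreedySorts t p) L
      × (t ! * (suc t) ^ (n ∸ t) ≤ length L)
mainTheorem6 t n t≥1 t≤n =
  map (map suc) (boundedPerms t n) ,
  Unique.map⁺ (map-injective suc-injective) (boundedPerms-unique t n) ,
  AllP.map⁺ (All.map sortable (boundedPerms-sound t n)) ,
  ≤-reflexive count
  where
  open ≡-Reasoning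
  sortable : ∀ {p} → BoundedPerm t n p → (map suc p ↭ oneTo n) × LeftGreedySorts t (map suc p)
  sortable (p↭ , few) = ↭.map⁺ suc p↭ , leftGreedy-sorts t≥1 (AtMostLargerBefore-map-suc [] _ few)
  count : t ! * suc t ^ (n ∸ t) ≡ length (map (map suc) (boundedPerms t n))
  count = begin
    t ! * suc t ^ (n ∸ t)                     ≡⟨ length-boundedPerms t (n ∸ t) ⟨
    length (boundedPerms t (n ∸ t + t))       ≡⟨ cong (λ m → length (boundedPerms t m)) (m∸n+n≡m t≤n) ⟩
    length (boundedPerms t n)                 ≡⟨ length-map (map suc) (boundedPerms t n) ⟨
    length (map (map suc) (boundedPerms t n)) ∎
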